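{- Let $p$ be a prime, $d\ge3$ an odd integer and $f\ge1$ an integer with $p^f>3$. Let $S$ be the free pro-$p$ group on $x_1,\dots,x_d$, let $R$ be the closed normal subgroup of $S$ generated by $r=x_1^{p^f}[x_2,x_3][x_4,x_5]\cdots[x_{d-1},x_d]$, and let $G=S/R$. Then for all $\varphi_1,\varphi_2,\varphi_3\in H^1(G,\mathbb{Z}/p)$, the triple Massey product $\langle\varphi_1,\varphi_2,\varphi_3\rangle$ is not essential.
   Context: $[a,b]=a^{ -1}b^{ -1}ab$; $\mathbb{Z}/p$ is a trivial $G$-module and $H^1(G,\mathbb{Z}/p)=\mathrm{Hom}_{cont}(G,\mathbb{F}_p)$. The triple Massey product $\langle\varphi_1,\varphi_2,\varphi_3\rangle\subseteq H^2(G,\mathbb{Z}/p)$ is the usual (multi-valued) Massey product; it is called essential if it is non-empty but does not contain $0$. Equivalently (Dwyer): let $\mathbb{U}_4(\mathbb{F}_p)$ be the group of unipotent upper-triangular $4\times4$ matrices over $\mathbb{F}_p$ and $\bar{\mathbb{U}}_4(\mathbb{F}_p)$ its quotient by its center $\{I+aE_{1,4}\}$; the product is non-empty iff there is a continuous homomorphism $\gamma\colon G\to\bar{\mathbb{U}}_4(\mathbb{F}_p)$ whose $(i,i+1)$-entries are $\varphi_i$ ($i=1,2,3$), and contains $0$ iff there is such a continuous homomorphism $G\to\mathbb{U}_4(\mathbb{F}_p)$. -}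

module Defs where

open import Data.Nat using (ℕ; zero; suc; _+_; _*_; _∸_; _<_; _<?_; _/_; NonZero)
open import Data.Nat.DivMod using (_mod_)
open import Data.Fin using (Fin; toℕ; fromℕ<)
open import Data.Product using (Σ; _×_; _,_)
open import Relation.Nullary using (¬_; yes; no)
open import Relation.Binary.PropositionalEquality using (_≡_)

module Fp (p : ℕ) .{{_ : NonZero p}} where
  infixl 6 _⊕_ _⊖_
  infixl 7 _⊗_

  𝟘 : Fin p
  𝟘 = 0 mod p

  _⊕_ : Fin p → Fin p → Fin p
  a ⊕ b = (toℕ a + toℕ b) mod p

  _⊗_ : Fin p → Fin p → Fin p
  a ⊗ b = (toℕ a * toℕ b) mod p

  ⊝_ : Fin p → Fin p
  ⊝ a = (p ∸ toℕ a) mod p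

  _⊖_ : Fin p → Fin p → Fin p
  a ⊖ b = a ⊕ (⊝ b)

-- Group operations (carrier, multiplication, inverse, unit); only the
-- data needed to evaluate group words.

record GrpOps : Set₁ where
  field
    Carrier : Set
    _·_     : Carrier → Carrier → Carrier
    inv     : Carrier → Carrier
    e       : Carrier

module Words (G : GrpOps) where
  open GrpOps G

  pow : Carrier → ℕ → Carrier
  pow g zero    = e
  pow g (suc n) = g · pow g n

  comm : Carrier → Carrier → Carrier
  comm a b = ((inv a · inv b) · a) · b

  -- 0-indexed access to a d-tuple of group elements (unit out of range)
  at : {d : ℕ} → (Fin d → Carrier) → ℕ → Carrier
  at {d} g i with i <? d
  ... | yes i<d = g (fromℕ< i<d)
  ... | no  _   = e

  -- [x_{2k},x_{2k+1}] [x_{2k+2},x_{2k+3}] ⋯ [x_{2(k+n)-2},x_{2(k+n)-1}]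
  -- (1-indexed generators x_1,…,x_d are at 0-indices 0,…,d-1)
  commProd : {d : ℕ} → (Fin d → Carrier) → ℕ → ℕ → Carrier
  commProd g k zero    = e
  commProd g k (suc n) =
    comm (at g (2 * k ∸ 1)) (at g (2 * k)) · commProd g (suc k) n

  -- value of r = x_1^{q} [x_2,x_3][x_4,x_5]⋯[x_{d-1},x_d]
  -- at x_i ↦ g (i-1), with q = p^f
  relator : (q : ℕ) {d : ℕ} → (Fin d → Carrier) → Carrier
  relator q {d} g = pow (at g 0) q · commProd g 1 (d / 2)

module Groups (p : ℕ) .{{_ : NonZero p}} where
  open Fp p

  Fp⁺ : GrpOps
  Fp⁺ = record { Carrier = Fin p ; _·_ = _⊕_ ; inv = ⊝_ ; e = 𝟘 }

  -- unipotent upper triangular 4×4 matrix I + Σ_{i<j} a_ij E_ij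
  record U4 : Set where
    constructor u4
    field
      a12 a13 a14 a23 a24 a34 : Fin p

  open U4

  mulU4 : U4 → U4 → U4
  mulU4 A B = u4
    (a12 A ⊕ a12 B)
    (a13 A ⊕ a12 A ⊗ a23 B ⊕ a13 B)
    (a14 A ⊕ a12 A ⊗ a24 B ⊕ a13 A ⊗ a34 B ⊕ a14 B)
    (a23 A ⊕ a23 B)
    (a24 A ⊕ a23 A ⊗ a34 B ⊕ a24 B)
    (a34 A ⊕ a34 B)

  invU4 : U4 → U4
  invU4 A = u4
    (⊝ a12 A)
    (⊝ a13 A ⊕ a12 A ⊗ a23 A)
    (⊝ a14 A ⊕ a12 A ⊗ a24 A ⊕ a13 A ⊗ a34 A ⊖ a12 A ⊗ a23 A ⊗ a34 A)
    (⊝ a23 A)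
    (⊝ a24 A ⊕ a23 A ⊗ a34 A)
    (⊝ a34 A)

  oneU4 : U4
  oneU4 = u4 𝟘 𝟘 𝟘 𝟘 𝟘 𝟘

  U4G : GrpOps
  U4G = record { Carrier = U4 ; _·_ = mulU4 ; inv = invU4 ; e = oneU4 }

  -- Ū_4 = U_4 / centre {I + a E_14}: the (1,4)-entry is forgotten
  record U4bar : Set where
    constructor ub4
    field
      b12 b13 b23 b24 b34 : Fin p

  open U4bar

  mulU4bar : U4bar → U4bar → U4bar
  mulU4bar A B = ub4
    (b12 A ⊕ b12 B)
    (b13 A ⊕ b12 A ⊗ b23 B ⊕ b13 B)
    (b23 A ⊕ b23 B)
    (b24 A ⊕ b23 A ⊗ b34 B ⊕ b24 B)
    (b34 A ⊕ b34 B)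

  invU4bar : U4bar → U4bar
  invU4bar A = ub4
    (⊝ b12 A)
    (⊝ b13 A ⊕ b12 A ⊗ b23 A)
    (⊝ b23 A)
    (⊝ b24 A ⊕ b23 A ⊗ b34 A)
    (⊝ b34 A)

  oneU4bar : U4bar
  oneU4bar = ub4 𝟘 𝟘 𝟘 𝟘 𝟘

  U4barG : GrpOps
  U4barG = record { Carrier = U4bar ; _·_ = mulU4bar ; inv = invU4bar ; e = oneU4bar }

-- G = S/R, S free pro-p on x_1..x_d, R normally generated by r.
-- A continuous homomorphism G → K (K a finite p-group) is the same as a
-- d-tuple (images of x_1..x_d) on which r evaluates to 1.

module OneRelator (p f : ℕ) .{{_ : NonZero p}} (d : ℕ) where
  open Groups p
  open Fp p
  open U4
  open U4bar

  q : ℕ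
  q = p Data.Nat.^ f

  -- H¹(G, ℤ/p) = Hom_cont(G, F_p)
  H1 : Set
  H1 = Σ (Fin d → Fin p) λ φ → Words.relator Fp⁺ q φ ≡ 𝟘

  -- Massey product ⟨φ₁,φ₂,φ₃⟩ is non-empty (Dwyer): a hom G → Ū_4(F_p)
  -- with superdiagonal entries φ₁, φ₂, φ₃.
  MasseyNonEmpty : H1 → H1 → H1 → Set
  MasseyNonEmpty (φ₁ , _) (φ₂ , _) (φ₃ , _) =
    Σ (Fin d → U4bar) λ γ →
      (Words.relator U4barG q γ ≡ oneU4bar) ×
      ((i : Fin d) → (b12 (γ i) ≡ φ₁ i) × (b23 (γ i) ≡ φ₂ i) × (b34 (γ i) ≡ φ₃ i))

  -- ⟨φ₁,φ₂,φ₃⟩ contains 0 (Dwyer): a hom G → U_4(F_p) with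
  -- superdiagonal entries φ₁, φ₂, φ₃.
  MasseyContainsZero : H1 → H1 → H1 → Set
  MasseyContainsZero (φ₁ , _) (φ₂ , _) (φ₃ , _) =
    Σ (Fin d → U4) λ γ →
      (Words.relator U4G q γ ≡ oneU4) ×
      ((i : Fin d) → (a12 (γ i) ≡ φ₁ i) × (a23 (γ i) ≡ φ₂ i) × (a34 (γ i) ≡ φ₃ i))

  Essential : H1 → H1 → H1 → Set
  Essential φ₁ φ₂ φ₃ = MasseyNonEmpty φ₁ φ₂ φ₃ × ¬ MasseyContainsZero φ₁ φ₂ φ₃

{-# OPTIONS --safe #-}
module Submission where

open import Defs
open import Data.Nat using (ℕ; zero; suc; NonZero; ≢-nonZero; _+_; _*_; _∸_; _^_; _/_; _%_; _≤_; _<_; s≤s; z≤n)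
open import Data.Nat.Primality using (Prime)
open import Data.Fin using (Fin; toℕ; fromℕ<)
open import Data.Product using (_×_; _,_; proj₁; proj₂; ∃-syntax; ∃₂)
open import Data.Sum using (_⊎_; inj₁; inj₂; [_,_]′)
open import Function.Base using (id; _∘_; _∘₂_; _on_)
open import Relation.Nullary using (¬_; Dec; yes; no; contradiction)
open import Relation.Binary.PropositionalEquality

-- By Dwyer's criterion, a homomorphism γ̄ : G → Ū₄(F_p) with superdiagonal (φ₁, φ₂, φ₃), i.e. a
-- tuple of matrices on which the relator r evaluates to 1, has to be lifted to such a tuple in
-- U₄(F_p). Since p ^ f > 3, the binomial expansion (1 + N)ⁿ = 1 + n N + (n C 2) N² + (n C 3) N³
-- shows that every element of U₄(F_p) has order dividing p ^ f, so r evaluates to the product of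
-- commutators [x₂, x₃] ⋯ [x_{d-1}, x_d], an element of the abelian subgroup {a₁₂ = a₂₃ = a₃₄ = 0}.
-- Its (1,3)- and (2,4)-entries only depend on the superdiagonals, so they vanish as they do in
-- Ū₄. Its (1,4)-entry is affine in the (1,3)- and (2,4)-entries of the lifts, the slopes being
-- superdiagonal entries of the partner in the commutator: if a slope is nonzero the entry can be
-- solved for, and if all slopes vanish so does the (1,4)-entry.

module ModularArithmetic (p : ℕ) .{{_ : NonZero p}} where
  open import Algebra.Bundles using (CommutativeRing)
  open import Algebra.Consequences.Propositional using (comm∧idˡ⇒id; comm∧invʳ⇒inv; comm∧distrʳ⇒distrˡ)
  open import Algebra.Solver.Ring.AlmostCommutativeRing using (_-Raw-AlmostCommutative⟶_; fromCommutativeRing)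
  import Algebra.Properties.Ring as RingProperties
  import Algebra.Properties.CommutativeSemigroup as CommutativeSemigroupProperties
  import Data.Nat.Properties as ℕ
  open import Data.Nat.DivMod using (_mod_; %-distribˡ-+; %-distribˡ-*; m<n⇒m%n≡m; m*n%n≡0; m%n<n)
  open import Data.Nat.Divisibility using (_∣_; ∣-refl; n∣m⇒m%n≡0; n∣m*n)
  open import Data.Nat.Coprimality using (prime⇒coprime; coprime-Bézout)
  open import Data.Nat.GCD using (module Bézout)
  open import Data.Fin.Properties using (toℕ-fromℕ<; toℕ<n; fromℕ<-cong; fromℕ<-toℕ)
  open import Data.Integer as ℤ using (ℤ; +_; -[1+_])
  import Data.Integer.Properties as ℤ
  import Data.Sign as Sign
  open import Data.Maybe as Maybe using ()
  open import Relation.Nullary.Decidable using (dec⇒maybe)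
  open Fp p

  ι : ℕ → Fin p
  ι n = n mod p

  𝟙 : Fin p
  𝟙 = ι 1

  ι-% : ∀ {m n} → m % p ≡ n % p → ι m ≡ ι n
  ι-% eq = fromℕ<-cong _ _ eq _ _

  toℕ-ι : ∀ n → toℕ (ι n) ≡ n % p
  toℕ-ι n = toℕ-fromℕ< (m%n<n n p)

  ι-toℕ : ∀ a → ι (toℕ a) ≡ a
  ι-toℕ a = trans (fromℕ<-cong _ _ (m<n⇒m%n≡m (toℕ<n a)) _ (toℕ<n a)) (fromℕ<-toℕ a _)

  ι-∣ : ∀ {n} → p ∣ n → ι n ≡ 𝟘
  ι-∣ p∣n = ι-% (trans (n∣m⇒m%n≡0 _ p p∣n) (sym (m*n%n≡0 0 p)))

  ι-+ : ∀ m n → ι (m + n) ≡ ι m ⊕ ι n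
  ι-+ m n = ι-% (trans (%-distribˡ-+ m n p) (sym (cong₂ (λ a b → (a + b) % p) (toℕ-ι m) (toℕ-ι n))))

  ι-* : ∀ m n → ι (m * n) ≡ ι m ⊗ ι n
  ι-* m n = ι-% (trans (%-distribˡ-* m n p) (sym (cong₂ (λ a b → (a * b) % p) (toℕ-ι m) (toℕ-ι n))))

  private
    absorbˡ-+ : ∀ m n → ι (toℕ (ι m) + n) ≡ ι (m + n)
    absorbˡ-+ m n = trans (ι-+ _ n) (trans (cong (_⊕ ι n) (ι-toℕ (ι m))) (sym (ι-+ m n)))

    absorbʳ-+ : ∀ m n → ι (m + toℕ (ι n)) ≡ ι (m + n)
    absorbʳ-+ m n = trans (ι-+ m _) (trans (cong (ι m ⊕_) (ι-toℕ (ι n))) (sym (ι-+ m n)))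

    absorbˡ-* : ∀ m n → ι (toℕ (ι m) * n) ≡ ι (m * n)
    absorbˡ-* m n = trans (ι-* _ n) (trans (cong (_⊗ ι n) (ι-toℕ (ι m))) (sym (ι-* m n)))

    absorbʳ-* : ∀ m n → ι (m * toℕ (ι n)) ≡ ι (m * n)
    absorbʳ-* m n = trans (ι-* m _) (trans (cong (ι m ⊗_) (ι-toℕ (ι n))) (sym (ι-* m n)))

  ⊕-assoc : ∀ a b c → (a ⊕ b) ⊕ c ≡ a ⊕ (b ⊕ c)
  ⊕-assoc a b c = trans (absorbˡ-+ _ (toℕ c))
    (trans (cong ι (ℕ.+-assoc (toℕ a) _ _)) (sym (absorbʳ-+ (toℕ a) _)))

  ⊗-assoc : ∀ a b c → (a ⊗ b) ⊗ c ≡ a ⊗ (b ⊗ c)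
  ⊗-assoc a b c = trans (absorbˡ-* _ (toℕ c))
    (trans (cong ι (ℕ.*-assoc (toℕ a) _ _)) (sym (absorbʳ-* (toℕ a) _)))

  ⊕-comm : ∀ a b → a ⊕ b ≡ b ⊕ a
  ⊕-comm a b = cong ι (ℕ.+-comm (toℕ a) (toℕ b))

  ⊗-comm : ∀ a b → a ⊗ b ≡ b ⊗ a
  ⊗-comm a b = cong ι (ℕ.*-comm (toℕ a) (toℕ b))

  ⊕-identityˡ : ∀ a → 𝟘 ⊕ a ≡ a
  ⊕-identityˡ a = trans (absorbˡ-+ 0 (toℕ a)) (ι-toℕ a)

  ⊗-identityˡ : ∀ a → 𝟙 ⊗ a ≡ a
  ⊗-identityˡ a = trans (absorbˡ-* 1 (toℕ a)) (trans (cong ι (ℕ.*-identityˡ (toℕ a))) (ι-toℕ a))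

  ⊝-inverseʳ : ∀ a → a ⊕ ⊝ a ≡ 𝟘
  ⊝-inverseʳ a = trans (absorbʳ-+ (toℕ a) _)
    (trans (cong ι (ℕ.m+[n∸m]≡n (ℕ.<⇒≤ (toℕ<n a)))) (ι-∣ ∣-refl))

  ⊗-distribʳ-⊕ : ∀ a b c → (b ⊕ c) ⊗ a ≡ (b ⊗ a) ⊕ (c ⊗ a)
  ⊗-distribʳ-⊕ a b c = trans (absorbˡ-* _ (toℕ a))
    (trans (cong ι (ℕ.*-distribʳ-+ (toℕ a) (toℕ b) _)) (sym (trans (absorbˡ-+ _ _) (absorbʳ-+ _ _))))

  +-*-commutativeRing : CommutativeRing _ _
  +-*-commutativeRing = record
    { Carrier = Fin p ; _≈_ = _≡_ ; _+_ = _⊕_ ; _*_ = _⊗_ ; -_ = ⊝_ ; 0# = 𝟘 ; 1# = 𝟙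
    ; isCommutativeRing = record
      { isRing = record
        { +-isAbelianGroup = record
          { isGroup = record
            { isMonoid = record
              { isSemigroup = record
                { isMagma = record { isEquivalence = isEquivalence ; ∙-cong = cong₂ _⊕_ }
                ; assoc = ⊕-assoc }
              ; identity = comm∧idˡ⇒id ⊕-comm ⊕-identityˡ }
            ; inverse = comm∧invʳ⇒inv ⊕-comm ⊝-inverseʳ
            ; ⁻¹-cong = cong ⊝_ }
          ; comm = ⊕-comm }
        ; *-cong = cong₂ _⊗_
        ; *-assoc = ⊗-assoc
        ; *-identity = comm∧idˡ⇒id ⊗-comm ⊗-identityˡ
        ; distrib = comm∧distrʳ⇒distrˡ ⊗-comm ⊗-distribʳ-⊕ , ⊗-distribʳ-⊕ }
      ; *-comm = ⊗-comm } }

  open CommutativeRing +-*-commutativeRing using (ring; +-commutativeSemigroup)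
  open RingProperties ring
    using (-0#≈0#; -‿involutive; -‿+-comm; -‿distribˡ-*; -‿distribʳ-*; +-inverseʳ-unique; //-rightDividesˡ)
  open CommutativeSemigroupProperties +-commutativeSemigroup using (interchange)

  -- The modulus p is a variable, so the ring solver cannot compute with coefficients in Fin p
  -- (already 𝟙 ⊕ 𝟙 is stuck); its coefficients are taken in ℤ instead.
  ⟦_⟧ : ℤ → Fin p
  ⟦ + n ⟧      = ι n
  ⟦ -[1+ n ] ⟧ = ⊝ ι (suc n)

  private
    ⟦+◃⟧ : ∀ n → ⟦ Sign.+ ℤ.◃ n ⟧ ≡ ι n
    ⟦+◃⟧ zero    = refl
    ⟦+◃⟧ (suc n) = refl

    ⟦-◃⟧ : ∀ n → ⟦ Sign.- ℤ.◃ n ⟧ ≡ ⊝ ι n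
    ⟦-◃⟧ zero    = sym -0#≈0#
    ⟦-◃⟧ (suc n) = refl

    ⊖-cancelˡ : ∀ x y z → (z ⊕ x) ⊖ (z ⊕ y) ≡ x ⊖ y
    ⊖-cancelˡ x y z = begin
      (z ⊕ x) ⊕ ⊝ (z ⊕ y)     ≡⟨ cong ((z ⊕ x) ⊕_) (sym (-‿+-comm z y)) ⟩
      (z ⊕ x) ⊕ (⊝ z ⊕ ⊝ y)   ≡⟨ interchange z x (⊝ z) (⊝ y) ⟩
      (z ⊕ ⊝ z) ⊕ (x ⊕ ⊝ y)   ≡⟨ cong (_⊕ (x ⊖ y)) (⊝-inverseʳ z) ⟩
      𝟘 ⊕ (x ⊖ y)             ≡⟨ ⊕-identityˡ (x ⊖ y) ⟩
      x ⊖ y                   ∎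
      where open ≡-Reasoning

    ⟦⊖⟧ : ∀ m n → ⟦ m ℤ.⊖ n ⟧ ≡ ι m ⊖ ι n
    ⟦⊖⟧ m       zero    = sym (trans (cong (ι m ⊕_) -0#≈0#) (trans (⊕-comm (ι m) 𝟘) (⊕-identityˡ (ι m))))
    ⟦⊖⟧ zero    (suc n) = sym (⊕-identityˡ _)
    ⟦⊖⟧ (suc m) (suc n) = begin
      ⟦ suc m ℤ.⊖ suc n ⟧      ≡⟨ cong ⟦_⟧ (ℤ.[1+m]⊖[1+n]≡m⊖n m n) ⟩
      ⟦ m ℤ.⊖ n ⟧              ≡⟨ ⟦⊖⟧ m n ⟩
      ι m ⊖ ι n                ≡⟨ sym (⊖-cancelˡ (ι m) (ι n) 𝟙) ⟩
      (𝟙 ⊕ ι m) ⊖ (𝟙 ⊕ ι n)    ≡⟨ sym (cong₂ _⊖_ (ι-+ 1 m) (ι-+ 1 n)) ⟩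
      ι (suc m) ⊖ ι (suc n)    ∎
      where open ≡-Reasoning

    ⟦⟧-+ : ∀ i j → ⟦ i ℤ.+ j ⟧ ≡ ⟦ i ⟧ ⊕ ⟦ j ⟧
    ⟦⟧-+ (+ m)    (+ n)    = ι-+ m n
    ⟦⟧-+ (+ m)    -[1+ n ] = ⟦⊖⟧ m (suc n)
    ⟦⟧-+ -[1+ m ] (+ n)    = trans (⟦⊖⟧ n (suc m)) (⊕-comm (ι n) _)
    ⟦⟧-+ -[1+ m ] -[1+ n ] = begin
      ⊝ ι (suc (suc (m + n)))      ≡⟨ cong (⊝_ ∘ ι) (sym (ℕ.+-suc (suc m) n)) ⟩
      ⊝ ι (suc m + suc n)          ≡⟨ cong ⊝_ (ι-+ (suc m) (suc n)) ⟩
      ⊝ (ι (suc m) ⊕ ι (suc n))    ≡⟨ sym (-‿+-comm (ι (suc m)) (ι (suc n))) ⟩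
      ⊝ ι (suc m) ⊕ ⊝ ι (suc n)    ∎
      where open ≡-Reasoning

    ⟦⟧-* : ∀ i j → ⟦ i ℤ.* j ⟧ ≡ ⟦ i ⟧ ⊗ ⟦ j ⟧
    ⟦⟧-* (+ m)    (+ n)    = trans (⟦+◃⟧ (m * n)) (ι-* m n)
    ⟦⟧-* (+ m)    -[1+ n ] =
      trans (⟦-◃⟧ (m * suc n)) (trans (cong ⊝_ (ι-* m (suc n))) (-‿distribʳ-* (ι m) (ι (suc n))))
    ⟦⟧-* -[1+ m ] (+ n)    =
      trans (⟦-◃⟧ (suc m * n)) (trans (cong ⊝_ (ι-* (suc m) n)) (-‿distribˡ-* (ι (suc m)) (ι n)))
    ⟦⟧-* -[1+ m ] -[1+ n ] = begin
      ⟦ Sign.+ ℤ.◃ (suc m * suc n) ⟧   ≡⟨ ⟦+◃⟧ (suc m * suc n) ⟩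
      ι (suc m * suc n)                ≡⟨ ι-* (suc m) (suc n) ⟩
      x ⊗ y                            ≡⟨ sym (-‿involutive (x ⊗ y)) ⟩
      ⊝ ⊝ (x ⊗ y)                      ≡⟨ cong ⊝_ (-‿distribˡ-* x y) ⟩
      ⊝ (⊝ x ⊗ y)                      ≡⟨ -‿distribʳ-* (⊝ x) y ⟩
      ⊝ x ⊗ ⊝ y                        ∎
      where
      open ≡-Reasoning
      x y : Fin p
      x = ι (suc m)
      y = ι (suc n)

    ⟦⟧-‿ : ∀ i → ⟦ ℤ.- i ⟧ ≡ ⊝ ⟦ i ⟧
    ⟦⟧-‿ (+ zero)  = sym -0#≈0#
    ⟦⟧-‿ (+ suc n) = refl
    ⟦⟧-‿ -[1+ n ]  = sym (-‿involutive (ι (suc n)))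

  ℤ⟶Fin : ℤ.+-*-rawRing -Raw-AlmostCommutative⟶ fromCommutativeRing +-*-commutativeRing
  ℤ⟶Fin = record
    { ⟦_⟧ = ⟦_⟧ ; +-homo = ⟦⟧-+ ; *-homo = ⟦⟧-* ; -‿homo = ⟦⟧-‿ ; 0-homo = refl ; 1-homo = refl }

  open import Algebra.Solver.Ring ℤ.+-*-rawRing (fromCommutativeRing +-*-commutativeRing) ℤ⟶Fin
    (λ i j → Maybe.map (cong ⟦_⟧) (dec⇒maybe (i ℤ.≟ j))) public
    using (Polynomial; con; var; _:+_; _:*_; :-_; _:-_; prove)
    renaming (⟦_⟧ to ⟦_⟧ₚ; ⟦_⟧↓ to ⟦_⟧↓ₚ)

  ⊗-inverse : Prime p → ∀ c → c ≢ 𝟘 → ∃[ c⁻¹ ] c⁻¹ ⊗ c ≡ 𝟙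
  ⊗-inverse p-prime c c≢𝟘 = from-Bézout (coprime-Bézout (prime⇒coprime p-prime {{≢-nonZero c≢0}} (toℕ<n c)))
    where
    open ≡-Reasoning
    c≢0 : toℕ c ≢ 0
    c≢0 c≡0 = c≢𝟘 (trans (sym (ι-toℕ c)) (cong ι c≡0))
    ι-*c : ∀ y → ι y ⊗ c ≡ ι (y * toℕ c)
    ι-*c y = trans (cong (ι y ⊗_) (sym (ι-toℕ c))) (sym (ι-* y (toℕ c)))
    from-Bézout : Bézout.Identity 1 p (toℕ c) → ∃[ c⁻¹ ] c⁻¹ ⊗ c ≡ 𝟙
    from-Bézout (Bézout.+- x y 1+yc≡xp) = ⊝ ι y , (begin
      ⊝ ι y ⊗ c      ≡⟨ sym (-‿distribˡ-* (ι y) c) ⟩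
      ⊝ (ι y ⊗ c)    ≡⟨ cong ⊝_ (+-inverseʳ-unique 𝟙 (ι y ⊗ c) 𝟙+yc≡𝟘) ⟩
      ⊝ ⊝ 𝟙          ≡⟨ -‿involutive 𝟙 ⟩
      𝟙              ∎)
      where
      𝟙+yc≡𝟘 : 𝟙 ⊕ ι y ⊗ c ≡ 𝟘
      𝟙+yc≡𝟘 = begin
        𝟙 ⊕ ι y ⊗ c            ≡⟨ cong (𝟙 ⊕_) (ι-*c y) ⟩
        𝟙 ⊕ ι (y * toℕ c)      ≡⟨ sym (ι-+ 1 (y * toℕ c)) ⟩
        ι (1 + y * toℕ c)      ≡⟨ cong ι 1+yc≡xp ⟩
        ι (x * p)              ≡⟨ ι-∣ (n∣m*n x) ⟩
        𝟘                      ∎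
    from-Bézout (Bézout.-+ x y 1+xp≡yc) = ι y , (begin
      ι y ⊗ c                ≡⟨ ι-*c y ⟩
      ι (y * toℕ c)          ≡⟨ cong ι (sym 1+xp≡yc) ⟩
      ι (1 + x * p)          ≡⟨ ι-+ 1 (x * p) ⟩
      𝟙 ⊕ ι (x * p)          ≡⟨ cong (𝟙 ⊕_) (ι-∣ (n∣m*n x)) ⟩
      𝟙 ⊕ 𝟘                  ≡⟨ ⊕-comm 𝟙 𝟘 ⟩
      𝟘 ⊕ 𝟙                  ≡⟨ ⊕-identityˡ 𝟙 ⟩
      𝟙                      ∎)

  ⊗-⊕-surjective : Prime p → ∀ {c} → c ≢ 𝟘 → ∀ b t → ∃[ s ] s ⊗ c ⊕ b ≡ t
  ⊗-⊕-surjective p-prime {c} c≢𝟘 b t = (t ⊖ b) ⊗ c⁻¹ , (begin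
    (t ⊖ b) ⊗ c⁻¹ ⊗ c ⊕ b      ≡⟨ cong (_⊕ b) (⊗-assoc (t ⊖ b) c⁻¹ c) ⟩
    (t ⊖ b) ⊗ (c⁻¹ ⊗ c) ⊕ b    ≡⟨ cong (λ x → (t ⊖ b) ⊗ x ⊕ b) (proj₂ inverse) ⟩
    (t ⊖ b) ⊗ 𝟙 ⊕ b            ≡⟨ cong (_⊕ b) (trans (⊗-comm (t ⊖ b) 𝟙) (⊗-identityˡ (t ⊖ b))) ⟩
    (t ⊖ b) ⊕ b                ≡⟨ //-rightDividesˡ b t ⟩
    t                          ∎)
    where
    open ≡-Reasoning
    inverse : ∃[ c⁻¹ ] c⁻¹ ⊗ c ≡ 𝟙
    inverse = ⊗-inverse p-prime c c≢𝟘
    c⁻¹ : Fin p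
    c⁻¹ = proj₁ inverse

module Binomials where
  open import Data.Nat using (_≟_; nonTrivial⇒n>1; z<s)
  open import Data.Nat.Properties
  open import Data.Nat.Combinatorics using (_C_; nC1≡n; nCk+nC[k+1]≡[n+1]C[k+1])
  open import Data.Nat.Divisibility
  open import Data.Nat.Primality using (euclidsLemma; prime⇒nonTrivial)
  open import Data.Nat.Tactic.RingSolver using (solve-∀)
  open ≡-Reasoning

  infix 4 _∣choose≤3_
  _∣choose≤3_ : ℕ → ℕ → Set
  p ∣choose≤3 n = p ∣ n × p ∣ n C 2 × p ∣ n C 3

  [1+n]C2≡n+nC2 : ∀ n → suc n C 2 ≡ n + n C 2
  [1+n]C2≡n+nC2 n = trans (sym (nCk+nC[k+1]≡[n+1]C[k+1] n 1)) (cong (_+ n C 2) (nC1≡n n))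

  [1+n]C3≡nC2+nC3 : ∀ n → suc n C 3 ≡ n C 2 + n C 3
  [1+n]C3≡nC2+nC3 n = sym (nCk+nC[k+1]≡[n+1]C[k+1] n 2)

  [m+n]C2≡mC2+nC2+m*n : ∀ m n → (m + n) C 2 ≡ m C 2 + n C 2 + m * n
  [m+n]C2≡mC2+nC2+m*n zero    n = sym (+-identityʳ (n C 2))
  [m+n]C2≡mC2+nC2+m*n (suc m) n = begin
    suc (m + n) C 2                      ≡⟨ [1+n]C2≡n+nC2 (m + n) ⟩
    m + n + (m + n) C 2                  ≡⟨ cong (m + n +_) ([m+n]C2≡mC2+nC2+m*n m n) ⟩
    m + n + (m C 2 + n C 2 + m * n)      ≡⟨ regroup m n (m C 2) (n C 2) ⟩
    (m + m C 2) + n C 2 + (n + m * n)    ≡⟨ cong (λ x → x + n C 2 + suc m * n) (sym ([1+n]C2≡n+nC2 m)) ⟩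
    suc m C 2 + n C 2 + suc m * n        ∎
    where
    regroup : ∀ m n x y → m + n + (x + y + m * n) ≡ (m + x) + y + (n + m * n)
    regroup = solve-∀

  -- _C_ binds more loosely than _*_, hence the parentheses in (m C 2) * n.
  [m+n]C3≡mC3+nC3+mC2*n+m*nC2 : ∀ m n → (m + n) C 3 ≡ m C 3 + n C 3 + (m C 2) * n + m * (n C 2)
  [m+n]C3≡mC3+nC3+mC2*n+m*nC2 zero    n = sym (trans (+-identityʳ _) (+-identityʳ (n C 3)))
  [m+n]C3≡mC3+nC3+mC2*n+m*nC2 (suc m) n = begin
    suc (m + n) C 3
      ≡⟨ [1+n]C3≡nC2+nC3 (m + n) ⟩
    (m + n) C 2 + (m + n) C 3
      ≡⟨ cong₂ _+_ ([m+n]C2≡mC2+nC2+m*n m n) ([m+n]C3≡mC3+nC3+mC2*n+m*nC2 m n) ⟩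
    (m C 2 + n C 2 + m * n) + (m C 3 + n C 3 + (m C 2) * n + m * (n C 2))
      ≡⟨ regroup m n (m C 2) (n C 2) (m C 3) (n C 3) ⟩
    (m C 2 + m C 3) + n C 3 + (m + m C 2) * n + (n C 2 + m * (n C 2))
      ≡⟨ cong₂ (λ x y → x + n C 3 + y * n + suc m * (n C 2)) (sym ([1+n]C3≡nC2+nC3 m)) (sym ([1+n]C2≡n+nC2 m)) ⟩
    suc m C 3 + n C 3 + (suc m C 2) * n + suc m * (n C 2)
      ∎
    where
    regroup : ∀ m n x y z w → (x + y + m * n) + (z + w + x * n + m * y) ≡ (x + z) + w + (m + x) * n + (y + m * y)
    regroup = solve-∀

  ∣choose≤3-*ˡ : ∀ {p e} → p ∣choose≤3 e → ∀ t → p ∣choose≤3 t * e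
  ∣choose≤3-*ˡ {p}     _                       zero    = p ∣0 , p ∣0 , p ∣0
  ∣choose≤3-*ˡ {p} {e} p∣e@(∣e , ∣eC2 , ∣eC3) (suc t) = step (∣choose≤3-*ˡ p∣e t)
    where
    step : p ∣choose≤3 t * e → p ∣choose≤3 suc t * e
    step (∣te , ∣teC2 , ∣teC3) =
      ∣m∣n⇒∣m+n ∣e ∣te ,
      subst (p ∣_) (sym ([m+n]C2≡mC2+nC2+m*n e (t * e)))
        (∣m∣n⇒∣m+n (∣m∣n⇒∣m+n ∣eC2 ∣teC2) (∣n⇒∣m*n e ∣te)) ,
      subst (p ∣_) (sym ([m+n]C3≡mC3+nC3+mC2*n+m*nC2 e (t * e)))
        (∣m∣n⇒∣m+n (∣m∣n⇒∣m+n (∣m∣n⇒∣m+n ∣eC3 ∣teC3) (∣m⇒∣m*n (t * e) ∣eC2))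
                   (∣n⇒∣m*n e ∣teC2))

  ∣choose≤3-∣ : ∀ {p e n} → p ∣choose≤3 e → e ∣ n → p ∣choose≤3 n
  ∣choose≤3-∣ p∣e (divides-refl t) = ∣choose≤3-*ˡ p∣e t

  n+2*nC2≡n*n : ∀ n → n + 2 * (n C 2) ≡ n * n
  n+2*nC2≡n*n zero    = refl
  n+2*nC2≡n*n (suc n) = begin
    suc n + 2 * (suc n C 2)           ≡⟨ cong (λ x → suc n + 2 * x) ([1+n]C2≡n+nC2 n) ⟩
    suc n + 2 * (n + n C 2)           ≡⟨ regroup n (n C 2) ⟩
    (n + 2 * (n C 2)) + (2 * n + 1)   ≡⟨ cong (_+ (2 * n + 1)) (n+2*nC2≡n*n n) ⟩
    n * n + (2 * n + 1)               ≡⟨ square-suc n ⟩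
    suc n * suc n                     ∎
    where
    regroup : ∀ n x → suc n + 2 * (n + x) ≡ (n + 2 * x) + (2 * n + 1)
    regroup = solve-∀
    square-suc : ∀ n → n * n + (2 * n + 1) ≡ suc n * suc n
    square-suc = solve-∀

  n+6*nC2+6*nC3≡n*n*n : ∀ n → n + 6 * (n C 2) + 6 * (n C 3) ≡ n * n * n
  n+6*nC2+6*nC3≡n*n*n zero    = refl
  n+6*nC2+6*nC3≡n*n*n (suc n) = begin
    suc n + 6 * (suc n C 2) + 6 * (suc n C 3)
      ≡⟨ cong₂ (λ x y → suc n + 6 * x + 6 * y) ([1+n]C2≡n+nC2 n) ([1+n]C3≡nC2+nC3 n) ⟩
    suc n + 6 * (n + n C 2) + 6 * (n C 2 + n C 3)
      ≡⟨ regroup n (n C 2) (n C 3) ⟩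
    (n + 6 * (n C 2) + 6 * (n C 3)) + 3 * (n + 2 * (n C 2)) + (3 * n + 1)
      ≡⟨ cong₂ (λ x y → x + 3 * y + (3 * n + 1)) (n+6*nC2+6*nC3≡n*n*n n) (n+2*nC2≡n*n n) ⟩
    n * n * n + 3 * (n * n) + (3 * n + 1)
      ≡⟨ cube-suc n ⟩
    suc n * suc n * suc n
      ∎
    where
    regroup : ∀ n x y → suc n + 6 * (n + x) + 6 * (x + y) ≡ (n + 6 * x + 6 * y) + 3 * (n + 2 * x) + (3 * n + 1)
    regroup = solve-∀
    cube-suc : ∀ n → n * n * n + 3 * (n * n) + (3 * n + 1) ≡ suc n * suc n * suc n
    cube-suc = solve-∀

  prime∣m*n⇒∣n : ∀ {p m n} → Prime p → 0 < m → m < p → p ∣ m * n → p ∣ n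
  prime∣m*n⇒∣n {p} {suc m} {n} p-prime _ m<p p∣mn =
    [ (λ p∣m → contradiction (∣⇒≤ p∣m) (<⇒≱ m<p)) , id ]′ (euclidsLemma (suc m) n p-prime p∣mn)

  prime>3⇒∣choose≤3 : ∀ {p} → Prime p → 3 < p → p ∣choose≤3 p
  prime>3⇒∣choose≤3 {p} p-prime 3<p = ∣-refl , p∣pC2 , p∣pC3
    where
    2<p : 2 < p
    2<p = <-trans (n<1+n 2) 3<p
    p∣pC2 : p ∣ p C 2
    p∣pC2 = prime∣m*n⇒∣n p-prime z<s 2<p
      (∣m+n∣m⇒∣n (subst (p ∣_) (sym (n+2*nC2≡n*n p)) (m∣m*n p)) ∣-refl)
    p∣6pC3 : p ∣ 6 * (p C 3)
    p∣6pC3 = ∣m+n∣m⇒∣n (subst (p ∣_) (sym (n+6*nC2+6*nC3≡n*n*n p)) (∣m⇒∣m*n p (m∣m*n p)))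
      (∣m∣n⇒∣m+n ∣-refl (∣n⇒∣m*n 6 p∣pC2))
    p∣pC3 : p ∣ p C 3
    p∣pC3 = prime∣m*n⇒∣n p-prime z<s 3<p
      (prime∣m*n⇒∣n p-prime z<s 2<p (subst (p ∣_) (*-assoc 2 3 (p C 3)) p∣6pC3))

  p*p∣p^f : ∀ p f → 1 < p → p < p ^ f → p * p ∣ p ^ f
  p*p∣p^f p zero          1<p p<1 = contradiction (<-trans 1<p p<1) (<-irrefl refl)
  p*p∣p^f p (suc zero)    _   p<p = contradiction (subst (p <_) (*-identityʳ p) p<p) (<-irrefl refl)
  p*p∣p^f p (suc (suc f)) _   _   = subst (p * p ∣_) (*-assoc p p (p ^ f)) (m∣m*n (p ^ f))

  p∣p^f : ∀ p f → 1 < p ^ f → p ∣ p ^ f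
  p∣p^f p zero    (s≤s ())
  p∣p^f p (suc f) _ = m∣m*n (p ^ f)

  -- The exponent of U₄(F_p) is p for p > 3 and p² for p ∈ {2, 3}; p ^ f is a multiple of it.
  prime-power-∣choose≤3 : ∀ {p f} → Prime p → 3 < p ^ f → p ∣choose≤3 p ^ f
  prime-power-∣choose≤3 {p} {f} p-prime 3<pᶠ = by-cases (p ≟ 2) (p ≟ 3)
    where
    by-cases : Dec (p ≡ 2) → Dec (p ≡ 3) → p ∣choose≤3 p ^ f
    by-cases (yes refl) _ = ∣choose≤3-∣ (divides 2 refl , divides 3 refl , divides 2 refl)
      (p*p∣p^f 2 f (s≤s (s≤s z≤n)) (<-trans (n<1+n 2) 3<pᶠ))
    by-cases (no _) (yes refl) = ∣choose≤3-∣ (divides 3 refl , divides 12 refl , divides 28 refl)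
      (p*p∣p^f 3 f (s≤s (s≤s z≤n)) 3<pᶠ)
    by-cases (no p≢2) (no p≢3) =
      ∣choose≤3-∣ (prime>3⇒∣choose≤3 p-prime 3<p) (p∣p^f p f (<-trans (s≤s (s≤s z≤n)) 3<pᶠ))
      where
      3<p : 3 < p
      3<p = ≤∧≢⇒< (≤∧≢⇒< (nonTrivial⇒n>1 p {{prime⇒nonTrivial p-prime}}) (p≢2 ∘ sym)) (p≢3 ∘ sym)

module WordsProperties where
  open import Data.Nat using (_<?_)
  open import Data.Fin.Properties using (toℕ<n; toℕ-fromℕ<; fromℕ<-toℕ; _≟_)
  open import Data.Vec.Functional using (updateAt)
  open import Data.Vec.Functional.Properties using (updateAt-updates; updateAt-minimal)
  open GrpOps

  module _ {G H : GrpOps} (h : Carrier G → Carrier H)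
           (h-· : ∀ x y → h (_·_ G x y) ≡ _·_ H (h x) (h y))
           (h-inv : ∀ x → h (inv G x) ≡ inv H (h x))
           (h-e : h (e G) ≡ e H) where
    private
      module G = Words G
      module H = Words H

    pow-natural : ∀ x n → h (G.pow x n) ≡ H.pow (h x) n
    pow-natural x zero    = h-e
    pow-natural x (suc n) = trans (h-· x _) (cong (_·_ H (h x)) (pow-natural x n))

    at-natural : ∀ {d} (g : Fin d → Carrier G) i → h (G.at g i) ≡ H.at (h ∘ g) i
    at-natural {d} g i with i <? d
    ... | yes _ = refl
    ... | no  _ = h-e

    comm-natural : ∀ x y → h (G.comm x y) ≡ H.comm (h x) (h y)
    comm-natural x y =
      trans (h-· _ y) (cong (λ z → _·_ H z (h y))
        (trans (h-· _ x) (cong (λ z → _·_ H z (h x))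
          (trans (h-· (inv G x) (inv G y)) (cong₂ (_·_ H) (h-inv x) (h-inv y))))))

    commProd-natural : ∀ {d} (g : Fin d → Carrier G) k n → h (G.commProd g k n) ≡ H.commProd (h ∘ g) k n
    commProd-natural g k zero    = h-e
    commProd-natural g k (suc n) = trans (h-· _ _) (cong₂ (_·_ H)
      (trans (comm-natural _ _) (cong₂ H.comm (at-natural g (2 * k ∸ 1)) (at-natural g (2 * k))))
      (commProd-natural g (suc k) n))

    relator-natural : ∀ q {d} (g : Fin d → Carrier G) → h (G.relator q g) ≡ H.relator q (h ∘ g)
    relator-natural q {d} g = trans (h-· _ _) (cong₂ (_·_ H)
      (trans (pow-natural _ q) (cong (λ x → H.pow x q) (at-natural g 0)))
      (commProd-natural g 1 (d / 2)))

  module _ (G : GrpOps) {d : ℕ} where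
    open Words G

    at-toℕ : ∀ (g : Fin d → Carrier G) i → at g (toℕ i) ≡ g i
    at-toℕ g i with toℕ i <? d
    ... | yes i<d = cong g (fromℕ<-toℕ i i<d)
    ... | no  i≮d = contradiction (toℕ<n i) i≮d

    at-updateAt-≢ : ∀ (g : Fin d → Carrier G) i f {j} → toℕ i ≢ j → at (updateAt g i f) j ≡ at g j
    at-updateAt-≢ g i f {j} i≢j with j <? d
    ... | yes j<d = updateAt-minimal (fromℕ< j<d) i g (λ j≡i → i≢j (trans (cong toℕ (sym j≡i)) (toℕ-fromℕ< j<d)))
    ... | no  _   = refl

    at-updateAt-≡ : ∀ (g : Fin d → Carrier G) i f {j} → toℕ i ≡ j → at (updateAt g i f) j ≡ f (at g j)
    at-updateAt-≡ g i f refl =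
      trans (at-toℕ (updateAt g i f) i) (trans (updateAt-updates i g) (cong f (sym (at-toℕ g i))))

    at-pointwise : ∀ (_∼_ : Carrier G → Carrier G → Set) {g g′ : Fin d → Carrier G} →
                   e G ∼ e G → (∀ i → g i ∼ g′ i) → ∀ j → at g j ∼ at g′ j
    at-pointwise _∼_ e∼e g∼g′ j with j <? d
    ... | yes j<d = g∼g′ (fromℕ< j<d)
    ... | no  _   = e∼e

  updateAt-pointwise : ∀ {A : Set} {n} (_∼_ : A → A → Set) {f : A → A} →
                       (∀ x → x ∼ x) → (∀ x → f x ∼ x) → ∀ (g : Fin n → A) i j → updateAt g i f j ∼ g j
  updateAt-pointwise _∼_ {f} ∼-refl f∼ g i j = by-cases (j ≟ i)
    where
    by-cases : Dec (j ≡ i) → updateAt g i f j ∼ g j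
    by-cases (yes refl) = subst (_∼ g j) (sym (updateAt-updates j g)) (f∼ (g j))
    by-cases (no j≢i)   = subst (_∼ g j) (sym (updateAt-minimal j i g j≢i)) (∼-refl (g j))

module Unitriangular (p : ℕ) .{{_ : NonZero p}} where
  open import Data.Nat.Combinatorics using (_C_)
  open import Data.Nat.Properties using (≤-refl; ≤-trans; m∸n≤m; ∸-monoˡ-≤; *-monoʳ-≤; n≤1+n)
  open import Data.Fin using (#_)
  open import Data.Vec using (Vec; _∷_; []; _++_)
  open import Data.Integer using (+_)
  open Fp p
  open ModularArithmetic p
  open Binomials
  open Groups p
  open U4
  open Words U4G

  u4-cong : ∀ {A B : U4} → a12 A ≡ a12 B → a13 A ≡ a13 B → a14 A ≡ a14 B →
            a23 A ≡ a23 B → a24 A ≡ a24 B → a34 A ≡ a34 B → A ≡ B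
  u4-cong refl refl refl refl refl refl = refl

  -- mulU4 and invU4 transcribed to solver syntax: ⟦ mulₚ A B ⟧ᵤ ρ is mulU4 (⟦ A ⟧ᵤ ρ) (⟦ B ⟧ᵤ ρ)
  -- by definition, so every identity below is checked by normalising its entries.
  record U4ₚ (n : ℕ) : Set where
    constructor u4ₚ
    field e12 e13 e14 e23 e24 e34 : Polynomial n
  open U4ₚ

  module _ {n : ℕ} where
    mulₚ : U4ₚ n → U4ₚ n → U4ₚ n
    mulₚ A B = u4ₚ
      (e12 A :+ e12 B)
      (e13 A :+ e12 A :* e23 B :+ e13 B)
      (e14 A :+ e12 A :* e24 B :+ e13 A :* e34 B :+ e14 B)
      (e23 A :+ e23 B)
      (e24 A :+ e23 A :* e34 B :+ e24 B)
      (e34 A :+ e34 B)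

    invₚ : U4ₚ n → U4ₚ n
    invₚ A = u4ₚ
      (:- e12 A)
      (:- e13 A :+ e12 A :* e23 A)
      (:- e14 A :+ e12 A :* e24 A :+ e13 A :* e34 A :- e12 A :* e23 A :* e34 A)
      (:- e23 A)
      (:- e24 A :+ e23 A :* e34 A)
      (:- e34 A)

    commₚ : U4ₚ n → U4ₚ n → U4ₚ n
    commₚ A B = mulₚ (mulₚ (mulₚ (invₚ A) (invₚ B)) A) B

    ⟦_⟧ᵤ ⟦_⟧↓ᵤ : U4ₚ n → Vec (Fin p) n → U4
    ⟦ A ⟧ᵤ ρ = u4 (⟦ e12 A ⟧ₚ ρ) (⟦ e13 A ⟧ₚ ρ) (⟦ e14 A ⟧ₚ ρ)
                  (⟦ e23 A ⟧ₚ ρ) (⟦ e24 A ⟧ₚ ρ) (⟦ e34 A ⟧ₚ ρ)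
    ⟦ A ⟧↓ᵤ ρ = u4 (⟦ e12 A ⟧↓ₚ ρ) (⟦ e13 A ⟧↓ₚ ρ) (⟦ e14 A ⟧↓ₚ ρ)
                   (⟦ e23 A ⟧↓ₚ ρ) (⟦ e24 A ⟧↓ₚ ρ) (⟦ e34 A ⟧↓ₚ ρ)

    proveᵤ : ∀ ρ (A B : U4ₚ n) → ⟦ A ⟧↓ᵤ ρ ≡ ⟦ B ⟧↓ᵤ ρ → ⟦ A ⟧ᵤ ρ ≡ ⟦ B ⟧ᵤ ρ
    proveᵤ ρ A B eq = u4-cong
      (prove ρ (e12 A) (e12 B) (cong a12 eq)) (prove ρ (e13 A) (e13 B) (cong a13 eq))
      (prove ρ (e14 A) (e14 B) (cong a14 eq)) (prove ρ (e23 A) (e23 B) (cong a23 eq))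
      (prove ρ (e24 A) (e24 B) (cong a24 eq)) (prove ρ (e34 A) (e34 B) (cong a34 eq))

  entries : U4 → Vec (Fin p) 6
  entries A = a12 A ∷ a13 A ∷ a14 A ∷ a23 A ∷ a24 A ∷ a34 A ∷ []

  -- the matrices of variables 0–5 and 6–11, evaluating to A and B at entries A ++ entries B ++ ⋯
  A⃗ : ∀ {n} → U4ₚ (6 + n)
  A⃗ = u4ₚ (var (# 0)) (var (# 1)) (var (# 2)) (var (# 3)) (var (# 4)) (var (# 5))

  B⃗ : ∀ {n} → U4ₚ (12 + n)
  B⃗ = u4ₚ (var (# 6)) (var (# 7)) (var (# 8)) (var (# 9)) (var (# 10)) (var (# 11))

  s⃗ : Polynomial 13
  s⃗ = var (# 12)

  0ₚ : ∀ {n} → Polynomial n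
  0ₚ = con (+ 0)

  -- I + x E₁₃ + y E₁₄ + z E₂₄, the general element of the derived subgroup [U₄, U₄]
  derived : Fin p → Fin p → Fin p → U4
  derived x y z = u4 𝟘 x y 𝟘 z 𝟘

  derivedₚ : ∀ {n} → Polynomial n → Polynomial n → Polynomial n → U4ₚ n
  derivedₚ x y z = u4ₚ 0ₚ x y 0ₚ z 0ₚ

  derived-mul : ∀ x y z x′ y′ z′ →
                mulU4 (derived x y z) (derived x′ y′ z′) ≡ derived (x ⊕ x′) (y ⊕ y′) (z ⊕ z′)
  derived-mul x y z x′ y′ z′ = proveᵤ (x ∷ y ∷ z ∷ x′ ∷ y′ ∷ z′ ∷ [])
    (mulₚ (derivedₚ (var (# 0)) (var (# 1)) (var (# 2))) (derivedₚ (var (# 3)) (var (# 4)) (var (# 5))))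
    (derivedₚ (var (# 0) :+ var (# 3)) (var (# 1) :+ var (# 4)) (var (# 2) :+ var (# 5))) refl

  mulU4-identityˡ : ∀ A → mulU4 oneU4 A ≡ A
  mulU4-identityˡ A = proveᵤ (entries A) (mulₚ (derivedₚ 0ₚ 0ₚ 0ₚ) A⃗) A⃗ refl

  comm-∈-derived : ∀ A B → comm A B ≡ derived (a13 (comm A B)) (a14 (comm A B)) (a24 (comm A B))
  comm-∈-derived A B = proveᵤ (entries A ++ entries B) [A,B] (derivedₚ (e13 [A,B]) (e14 [A,B]) (e24 [A,B])) refl
    where
    [A,B] : U4ₚ 12
    [A,B] = commₚ A⃗ B⃗

  comm-a13 : ∀ A B → a13 (comm A B) ≡ a12 A ⊗ a23 B ⊖ a23 A ⊗ a12 B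
  comm-a13 A B = prove (entries A ++ entries B) (e13 (commₚ A⃗ B⃗)) (e12 A⃗ :* e23 B⃗ :- e23 A⃗ :* e12 B⃗) refl

  comm-a24 : ∀ A B → a24 (comm A B) ≡ a23 A ⊗ a34 B ⊖ a34 A ⊗ a23 B
  comm-a24 A B = prove (entries A ++ entries B) (e24 (commₚ A⃗ B⃗)) (e23 A⃗ :* e34 B⃗ :- e34 A⃗ :* e23 B⃗) refl

  comm-a14-𝟘 : ∀ {A B} → a12 A ≡ 𝟘 → a34 A ≡ 𝟘 → a12 B ≡ 𝟘 → a34 B ≡ 𝟘 →
               a14 (comm A B) ≡ 𝟘
  comm-a14-𝟘 {A@(u4 _ _ _ _ _ _)} {B@(u4 _ _ _ _ _ _)} refl refl refl refl =
    prove (entries A ++ entries B)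
      (e14 (commₚ (record A⃗ { e12 = 0ₚ ; e34 = 0ₚ }) (record B⃗ { e12 = 0ₚ ; e34 = 0ₚ }))) 0ₚ refl

  infixl 6 _+₁₃_ _+₂₄_
  _+₁₃_ _+₂₄_ : U4 → Fin p → U4
  A +₁₃ s = record A { a13 = a13 A ⊕ s }
  A +₂₄ s = record A { a24 = a24 A ⊕ s }

  comm-a14-+₁₃ˡ : ∀ A B s → a14 (comm (A +₁₃ s) B) ≡ s ⊗ a34 B ⊕ a14 (comm A B)
  comm-a14-+₁₃ˡ A B s = prove (entries A ++ entries B ++ s ∷ [])
    (e14 (commₚ (record A⃗ { e13 = e13 A⃗ :+ s⃗ }) B⃗)) (s⃗ :* e34 B⃗ :+ e14 (commₚ A⃗ B⃗)) refl

  comm-a14-+₁₃ʳ : ∀ A B s → a14 (comm A (B +₁₃ ⊝ s)) ≡ s ⊗ a34 A ⊕ a14 (comm A B)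
  comm-a14-+₁₃ʳ A B s = prove (entries A ++ entries B ++ s ∷ [])
    (e14 (commₚ A⃗ (record B⃗ { e13 = e13 B⃗ :- s⃗ }))) (s⃗ :* e34 A⃗ :+ e14 (commₚ A⃗ B⃗)) refl

  comm-a14-+₂₄ˡ : ∀ A B s → a14 (comm (A +₂₄ ⊝ s) B) ≡ s ⊗ a12 B ⊕ a14 (comm A B)
  comm-a14-+₂₄ˡ A B s = prove (entries A ++ entries B ++ s ∷ [])
    (e14 (commₚ (record A⃗ { e24 = e24 A⃗ :- s⃗ }) B⃗)) (s⃗ :* e12 B⃗ :+ e14 (commₚ A⃗ B⃗)) refl

  comm-a14-+₂₄ʳ : ∀ A B s → a14 (comm A (B +₂₄ s)) ≡ s ⊗ a12 A ⊕ a14 (comm A B)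
  comm-a14-+₂₄ʳ A B s = prove (entries A ++ entries B ++ s ∷ [])
    (e14 (commₚ A⃗ (record B⃗ { e24 = e24 B⃗ :+ s⃗ }))) (s⃗ :* e12 A⃗ :+ e14 (commₚ A⃗ B⃗)) refl

  -- I + a N + b N² + c N³, where N = A − I
  binomialPower : U4 → Fin p → Fin p → Fin p → U4
  binomialPower A a b c = u4
    (a ⊗ a12 A)
    (a ⊗ a13 A ⊕ b ⊗ (a12 A ⊗ a23 A))
    (a ⊗ a14 A ⊕ b ⊗ (a12 A ⊗ a24 A ⊕ a13 A ⊗ a34 A) ⊕ c ⊗ (a12 A ⊗ a23 A ⊗ a34 A))
    (a ⊗ a23 A)
    (a ⊗ a24 A ⊕ b ⊗ (a23 A ⊗ a34 A))
    (a ⊗ a34 A)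

  binomialPowerₚ : ∀ {n} → U4ₚ n → Polynomial n → Polynomial n → Polynomial n → U4ₚ n
  binomialPowerₚ A a b c = u4ₚ
    (a :* e12 A)
    (a :* e13 A :+ b :* (e12 A :* e23 A))
    (a :* e14 A :+ b :* (e12 A :* e24 A :+ e13 A :* e34 A) :+ c :* (e12 A :* e23 A :* e34 A))
    (a :* e23 A)
    (a :* e24 A :+ b :* (e23 A :* e34 A))
    (a :* e34 A)

  binomialPower-𝟘 : ∀ A → binomialPower A 𝟘 𝟘 𝟘 ≡ oneU4
  binomialPower-𝟘 A = proveᵤ (entries A) (binomialPowerₚ A⃗ 0ₚ 0ₚ 0ₚ) (derivedₚ 0ₚ 0ₚ 0ₚ) refl

  binomialPower-suc : ∀ A a b c → mulU4 A (binomialPower A a b c) ≡ binomialPower A (𝟙 ⊕ a) (a ⊕ b) (b ⊕ c)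
  binomialPower-suc A a b c = proveᵤ (entries A ++ a ∷ b ∷ c ∷ [])
    (mulₚ A⃗ (binomialPowerₚ A⃗ a⃗ b⃗ c⃗))
    (binomialPowerₚ A⃗ (con (+ 1) :+ a⃗) (a⃗ :+ b⃗) (b⃗ :+ c⃗)) refl
    where
    a⃗ b⃗ c⃗ : Polynomial 9
    a⃗ = var (# 6)
    b⃗ = var (# 7)
    c⃗ = var (# 8)

  pow-binomialPower : ∀ A n → pow A n ≡ binomialPower A (ι n) (ι (n C 2)) (ι (n C 3))
  pow-binomialPower A zero    = sym (binomialPower-𝟘 A)
  pow-binomialPower A (suc n) = begin
    mulU4 A (pow A n)
      ≡⟨ cong (mulU4 A) (pow-binomialPower A n) ⟩
    mulU4 A (binomialPower A (ι n) (ι (n C 2)) (ι (n C 3)))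
      ≡⟨ binomialPower-suc A _ _ _ ⟩
    binomialPower A (𝟙 ⊕ ι n) (ι n ⊕ ι (n C 2)) (ι (n C 2) ⊕ ι (n C 3))
      ≡⟨ sym (cong₃ (binomialPower A) (ι-+ 1 n) (ι-+ n (n C 2)) (ι-+ (n C 2) (n C 3))) ⟩
    binomialPower A (ι (suc n)) (ι (n + n C 2)) (ι (n C 2 + n C 3))
      ≡⟨ sym (cong₂ (λ x y → binomialPower A (ι (suc n)) (ι x) (ι y)) ([1+n]C2≡n+nC2 n) ([1+n]C3≡nC2+nC3 n)) ⟩
    binomialPower A (ι (suc n)) (ι (suc n C 2)) (ι (suc n C 3))
      ∎
    where
    open ≡-Reasoning
    cong₃ : ∀ {A B C D : Set} (f : A → B → C → D) {x y z x′ y′ z′} →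
            x ≡ x′ → y ≡ y′ → z ≡ z′ → f x y z ≡ f x′ y′ z′
    cong₃ f refl refl refl = refl

  pow-≡-one : ∀ {n} → p ∣choose≤3 n → ∀ A → pow A n ≡ oneU4
  pow-≡-one {n} (p∣n , p∣nC2 , p∣nC3) A = begin
    pow A n                                          ≡⟨ pow-binomialPower A n ⟩
    binomialPower A (ι n) (ι (n C 2)) (ι (n C 3))    ≡⟨ cong₂ (binomialPower A (ι n)) (ι-∣ p∣nC2) (ι-∣ p∣nC3) ⟩
    binomialPower A (ι n) 𝟘 𝟘                        ≡⟨ cong (λ x → binomialPower A x 𝟘 𝟘) (ι-∣ p∣n) ⟩
    binomialPower A 𝟘 𝟘 𝟘                            ≡⟨ binomialPower-𝟘 A ⟩
    oneU4                                            ∎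
    where open ≡-Reasoning

  pairSum : (U4 → U4 → Fin p) → (ℕ → U4) → ℕ → ℕ → Fin p
  pairSum f Q k zero    = 𝟘
  pairSum f Q k (suc n) = f (Q (2 * k ∸ 1)) (Q (2 * k)) ⊕ pairSum f Q (suc k) n

  pairSum-cong : ∀ (_∼_ : U4 → U4 → Set) (f : U4 → U4 → Fin p) →
                 (∀ {A A′ B B′} → A ∼ A′ → B ∼ B′ → f A B ≡ f A′ B′) →
                 ∀ {Q Q′} k n → (∀ j → 2 * k ∸ 1 ≤ j → Q j ∼ Q′ j) → pairSum f Q k n ≡ pairSum f Q′ k n
  pairSum-cong _∼_ f f-cong k zero    Q∼Q′ = refl
  pairSum-cong _∼_ f f-cong k (suc n) Q∼Q′ = cong₂ _⊕_
    (f-cong (Q∼Q′ _ ≤-refl) (Q∼Q′ _ (m∸n≤m (2 * k) 1)))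
    (pairSum-cong _∼_ f f-cong (suc k) n
      (λ j 2k+1≤j → Q∼Q′ j (≤-trans (∸-monoˡ-≤ 1 (*-monoʳ-≤ 2 (n≤1+n k))) 2k+1≤j)))

  module _ {d : ℕ} (g : Fin d → U4) where
    Σ₁₃ Σ₁₄ Σ₂₄ : ℕ → ℕ → Fin p
    Σ₁₃ = pairSum (a13 ∘₂ comm) (at g)
    Σ₁₄ = pairSum (a14 ∘₂ comm) (at g)
    Σ₂₄ = pairSum (a24 ∘₂ comm) (at g)

    commProd-derived : ∀ k n → commProd g k n ≡ derived (Σ₁₃ k n) (Σ₁₄ k n) (Σ₂₄ k n)
    commProd-derived k zero    = refl
    commProd-derived k (suc n) = trans
      (cong₂ mulU4 (comm-∈-derived (at g (2 * k ∸ 1)) (at g (2 * k))) (commProd-derived (suc k) n))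
      (derived-mul _ _ _ _ _ _)

  relator-derived : ∀ {q} → p ∣choose≤3 q → ∀ {d} (g : Fin d → U4) →
                    relator q g ≡ derived (Σ₁₃ g 1 (d / 2)) (Σ₁₄ g 1 (d / 2)) (Σ₂₄ g 1 (d / 2))
  relator-derived {q} p∣q {d} g = begin
    mulU4 (pow (at g 0) q) (commProd g 1 (d / 2))
      ≡⟨ cong (λ x → mulU4 x (commProd g 1 (d / 2))) (pow-≡-one p∣q (at g 0)) ⟩
    mulU4 oneU4 (commProd g 1 (d / 2))
      ≡⟨ mulU4-identityˡ _ ⟩
    commProd g 1 (d / 2)
      ≡⟨ commProd-derived g 1 (d / 2) ⟩
    derived (Σ₁₃ g 1 (d / 2)) (Σ₁₄ g 1 (d / 2)) (Σ₂₄ g 1 (d / 2))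
      ∎
    where open ≡-Reasoning

module Lifting (p : ℕ) .{{_ : NonZero p}} (p-prime : Prime p) where
  open import Data.Nat.Properties using (+-suc; ≤-trans; ≤-reflexive; ≤-pred; n<1+n; <⇒≢; <-trans; 1+n≢n; m≤m+n)
  open import Data.Nat.DivMod using (m≡m%n+[m/n]*n)
  open import Data.Nat.Tactic.RingSolver using (solve-∀)
  open import Data.Fin.Properties using (toℕ-fromℕ<) renaming (_≟_ to _≟ᶠ_)
  open import Data.Vec.Functional using (updateAt)
  open import Algebra.Bundles using (CommutativeRing)
  import Algebra.Properties.Ring as RingProperties
  open Fp p
  open ModularArithmetic p
  open Binomials using (_∣choose≤3_)
  open WordsProperties
  open Unitriangular p
  open Groups p
  open U4
  open U4bar
  open Words U4G
  open CommutativeRing +-*-commutativeRing using (ring)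
  open RingProperties ring using (//-rightDividesˡ)

  superdiagonal : U4 → Fin p × Fin p × Fin p
  superdiagonal A = a12 A , a23 A , a34 A

  infix 4 _≈ₛ_
  _≈ₛ_ : U4 → U4 → Set
  _≈ₛ_ = _≡_ on superdiagonal

  comm-a13-cong : ∀ {A A′ B B′} → A ≈ₛ A′ → B ≈ₛ B′ → a13 (comm A B) ≡ a13 (comm A′ B′)
  comm-a13-cong {A} {A′} {B} {B′} A≈A′ B≈B′ = begin
    a13 (comm A B)                       ≡⟨ comm-a13 A B ⟩
    a12 A ⊗ a23 B ⊖ a23 A ⊗ a12 B
      ≡⟨ cong₂ (λ (u , v , _) (u′ , v′ , _) → u ⊗ v′ ⊖ v ⊗ u′) A≈A′ B≈B′ ⟩
    a12 A′ ⊗ a23 B′ ⊖ a23 A′ ⊗ a12 B′    ≡⟨ sym (comm-a13 A′ B′) ⟩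
    a13 (comm A′ B′)                     ∎
    where open ≡-Reasoning

  comm-a24-cong : ∀ {A A′ B B′} → A ≈ₛ A′ → B ≈ₛ B′ → a24 (comm A B) ≡ a24 (comm A′ B′)
  comm-a24-cong {A} {A′} {B} {B′} A≈A′ B≈B′ = begin
    a24 (comm A B)                       ≡⟨ comm-a24 A B ⟩
    a23 A ⊗ a34 B ⊖ a34 A ⊗ a23 B
      ≡⟨ cong₂ (λ (_ , v , w) (_ , v′ , w′) → v ⊗ w′ ⊖ w ⊗ v′) A≈A′ B≈B′ ⟩
    a23 A′ ⊗ a34 B′ ⊖ a34 A′ ⊗ a23 B′    ≡⟨ sym (comm-a24 A′ B′) ⟩
    a24 (comm A′ B′)                     ∎
    where open ≡-Reasoning

  Vanishing : U4 → U4 → Set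
  Vanishing A B = ∀ {A′ B′} → A′ ≈ₛ A → B′ ≈ₛ B → a14 (comm A′ B′) ≡ 𝟘

  Realisable : U4 → U4 → Fin p → Set
  Realisable A B t =
    ∃₂ λ (φ ψ : U4 → U4) → (∀ X → φ X ≈ₛ X) × (∀ X → ψ X ≈ₛ X) × a14 (comm (φ A) (ψ B)) ≡ t

  realisable-line : ∀ A B {c} → c ≢ 𝟘 →
                    (∀ s → Realisable A B (s ⊗ c ⊕ a14 (comm A B))) → ∀ t → Realisable A B t
  realisable-line A B {c} c≢𝟘 line t = subst (Realisable A B) (proj₂ solution) (line (proj₁ solution))
    where
    solution : ∃[ s ] s ⊗ c ⊕ a14 (comm A B) ≡ t
    solution = ⊗-⊕-surjective p-prime c≢𝟘 (a14 (comm A B)) t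

  some-≢𝟘-or-all-≡𝟘 : ∀ a b c e →
                      (a ≢ 𝟘 ⊎ b ≢ 𝟘 ⊎ c ≢ 𝟘 ⊎ e ≢ 𝟘) ⊎ (a ≡ 𝟘 × b ≡ 𝟘 × c ≡ 𝟘 × e ≡ 𝟘)
  some-≢𝟘-or-all-≡𝟘 a b c e with a ≟ᶠ 𝟘 | b ≟ᶠ 𝟘 | c ≟ᶠ 𝟘 | e ≟ᶠ 𝟘
  ... | no a≢𝟘  | _       | _       | _       = inj₁ (inj₁ a≢𝟘)
  ... | yes _   | no b≢𝟘  | _       | _       = inj₁ (inj₂ (inj₁ b≢𝟘))
  ... | yes _   | yes _   | no c≢𝟘  | _       = inj₁ (inj₂ (inj₂ (inj₁ c≢𝟘)))
  ... | yes _   | yes _   | yes _   | no e≢𝟘  = inj₁ (inj₂ (inj₂ (inj₂ e≢𝟘)))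
  ... | yes a≡𝟘 | yes b≡𝟘 | yes c≡𝟘 | yes e≡𝟘 = inj₂ (a≡𝟘 , b≡𝟘 , c≡𝟘 , e≡𝟘)

  -- The (1,4)-entry of [A, B] is affine in the (1,3)- and (2,4)-entries of A and B, with slopes
  -- ± the (3,4)- and (1,2)-entries of the other matrix; a nonzero slope makes it take every value.
  comm-a14-dichotomy : ∀ A B → Vanishing A B ⊎ (∀ t → Realisable A B t)
  comm-a14-dichotomy A B = by-cases (some-≢𝟘-or-all-≡𝟘 (a34 B) (a34 A) (a12 B) (a12 A))
    where
    by-cases : (a34 B ≢ 𝟘 ⊎ a34 A ≢ 𝟘 ⊎ a12 B ≢ 𝟘 ⊎ a12 A ≢ 𝟘) ⊎
               (a34 B ≡ 𝟘 × a34 A ≡ 𝟘 × a12 B ≡ 𝟘 × a12 A ≡ 𝟘) →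
               Vanishing A B ⊎ (∀ t → Realisable A B t)
    by-cases (inj₁ (inj₁ c≢𝟘)) = inj₂ (realisable-line A B c≢𝟘 λ s →
      (_+₁₃ s) , id , (λ _ → refl) , (λ _ → refl) , comm-a14-+₁₃ˡ A B s)
    by-cases (inj₁ (inj₂ (inj₁ c≢𝟘))) = inj₂ (realisable-line A B c≢𝟘 λ s →
      id , (_+₁₃ ⊝ s) , (λ _ → refl) , (λ _ → refl) , comm-a14-+₁₃ʳ A B s)
    by-cases (inj₁ (inj₂ (inj₂ (inj₁ c≢𝟘)))) = inj₂ (realisable-line A B c≢𝟘 λ s →
      (_+₂₄ ⊝ s) , id , (λ _ → refl) , (λ _ → refl) , comm-a14-+₂₄ˡ A B s)
    by-cases (inj₁ (inj₂ (inj₂ (inj₂ c≢𝟘)))) = inj₂ (realisable-line A B c≢𝟘 λ s →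
      id , (_+₂₄ s) , (λ _ → refl) , (λ _ → refl) , comm-a14-+₂₄ʳ A B s)
    by-cases (inj₂ (a34B≡𝟘 , a34A≡𝟘 , a12B≡𝟘 , a12A≡𝟘)) = inj₁ λ {A′} {B′} A′≈A B′≈B →
      comm-a14-𝟘 {A′} {B′}
        (trans (cong proj₁ A′≈A) a12A≡𝟘) (trans (cong (proj₂ ∘ proj₂) A′≈A) a34A≡𝟘)
        (trans (cong proj₁ B′≈B) a12B≡𝟘) (trans (cong (proj₂ ∘ proj₂) B′≈B) a34B≡𝟘)

  2*[1+k]∸1≡1+2*k : ∀ k → 2 * suc k ∸ 1 ≡ suc (2 * k)
  2*[1+k]∸1≡1+2*k k = +-suc k (k + 0)

  module _ {d : ℕ} where
    infix 4 _≋ₛ_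
    _≋ₛ_ : (Fin d → U4) → (Fin d → U4) → Set
    g ≋ₛ h = ∀ i → g i ≈ₛ h i

    at-≈ₛ : ∀ {g h} → g ≋ₛ h → ∀ j → at g j ≈ₛ at h j
    at-≈ₛ = at-pointwise U4G _≈ₛ_ refl

    pair-in-range : ∀ k n → 2 * (k + suc n) ≤ suc d → 2 * k < d
    pair-in-range k n range =
      ≤-pred (≤-trans (s≤s (s≤s (m≤m+n (2 * k) (2 * n)))) (≤-trans (≤-reflexive (expand k n)) range))
      where
      expand : ∀ k n → suc (suc (2 * k + 2 * n)) ≡ 2 * (k + suc n)
      expand = solve-∀

    replace-pair : ∀ (g : Fin d → U4) k n → 2 * suc k < d →
      ∀ φ ψ → (∀ X → φ X ≈ₛ X) → (∀ X → ψ X ≈ₛ X) →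
      ∃[ g′ ] g′ ≋ₛ g × Σ₁₄ g′ (suc k) (suc n)
                         ≡ a14 (comm (φ (at g (2 * suc k ∸ 1))) (ψ (at g (2 * suc k)))) ⊕ Σ₁₄ g (suc (suc k)) n
    replace-pair g k n b<d φ ψ φ≈ ψ≈ = g″ , g″≋g ,
      cong₂ (λ x y → x ⊕ y) (cong₂ (λ A B → a14 (comm A B)) at-a at-b) rest
      where
      a b : ℕ
      a = 2 * suc k ∸ 1
      b = 2 * suc k
      a′ b′ : Fin d
      a′ = fromℕ< (<-trans (n<1+n a) b<d)
      b′ = fromℕ< b<d
      g′ g″ : Fin d → U4
      g′ = updateAt g a′ φ
      g″ = updateAt g′ b′ ψ
      g″≋g : g″ ≋ₛ g
      g″≋g i = trans (updateAt-pointwise _≈ₛ_ (λ _ → refl) ψ≈ g′ b′ i)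
                     (updateAt-pointwise _≈ₛ_ (λ _ → refl) φ≈ g a′ i)
      at-a : at g″ a ≡ φ (at g a)
      at-a = trans (at-updateAt-≢ U4G g′ b′ ψ (λ b≡a → 1+n≢n (trans (sym (toℕ-fromℕ< b<d)) b≡a)))
                   (at-updateAt-≡ U4G g a′ φ (toℕ-fromℕ< _))
      at-b : at g″ b ≡ ψ (at g b)
      at-b = trans (at-updateAt-≡ U4G g′ b′ ψ (toℕ-fromℕ< b<d))
                   (cong ψ (at-updateAt-≢ U4G g a′ φ (λ a≡b → 1+n≢n (sym (trans (sym (toℕ-fromℕ< _)) a≡b)))))
      unchanged : ∀ j → 2 * suc (suc k) ∸ 1 ≤ j → at g″ j ≡ at g j
      unchanged j j≥ =
        trans (at-updateAt-≢ U4G g′ b′ ψ (λ b≡j → <⇒≢ b<j (trans (sym (toℕ-fromℕ< b<d)) b≡j)))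
              (at-updateAt-≢ U4G g a′ φ
                (λ a≡j → <⇒≢ (<-trans (n<1+n a) b<j) (trans (sym (toℕ-fromℕ< _)) a≡j)))
        where
        b<j : b < j
        b<j = subst (_≤ j) (2*[1+k]∸1≡1+2*k (suc k)) j≥
      rest : Σ₁₄ g″ (suc (suc k)) n ≡ Σ₁₄ g (suc (suc k)) n
      rest = pairSum-cong _≡_ (a14 ∘₂ comm) (cong₂ (a14 ∘₂ comm)) (suc (suc k)) n unchanged

    VanishingOrAdjustable : (Fin d → U4) → ℕ → ℕ → Set
    VanishingOrAdjustable g k n = Σ₁₄ g k n ≡ 𝟘 ⊎ (∀ t → ∃[ g′ ] g′ ≋ₛ g × Σ₁₄ g′ k n ≡ t)

    Σ₁₄-dichotomy : ∀ n k → 2 * (suc k + n) ≤ suc d → ∀ g → VanishingOrAdjustable g (suc k) n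
    Σ₁₄-dichotomy zero    k _     g = inj₁ refl
    Σ₁₄-dichotomy (suc n) k range g =
      step (comm-a14-dichotomy (at g a) (at g b)) (Σ₁₄-dichotomy n (suc k) range′ g)
      where
      a b : ℕ
      a = 2 * suc k ∸ 1
      b = 2 * suc k
      range′ : 2 * (suc (suc k) + n) ≤ suc d
      range′ = subst (λ m → 2 * m ≤ suc d) (+-suc (suc k) n) range
      rest : Fin p
      rest = Σ₁₄ g (suc (suc k)) n
      step : Vanishing (at g a) (at g b) ⊎ (∀ t → Realisable (at g a) (at g b) t) →
             VanishingOrAdjustable g (suc (suc k)) n → VanishingOrAdjustable g (suc k) (suc n)
      step (inj₂ realisable) _ = inj₂ λ t →
        let φ , ψ , φ≈ , ψ≈ , a14≡t-rest = realisable (t ⊖ rest)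
            g′ , g′≋g , Σ₁₄g′≡ = replace-pair g k n (pair-in-range (suc k) n range) φ ψ φ≈ ψ≈
        in g′ , g′≋g , trans Σ₁₄g′≡ (trans (cong (_⊕ rest) a14≡t-rest) (//-rightDividesˡ rest t))
      step (inj₁ vanishes) (inj₁ rest≡𝟘) =
        inj₁ (trans (cong₂ _⊕_ (vanishes {at g a} {at g b} refl refl) rest≡𝟘) (⊕-identityˡ 𝟘))
      step (inj₁ vanishes) (inj₂ adjustable) = inj₂ λ t →
        let g′ , g′≋g , Σ₁₄g′≡t = adjustable t
        in g′ , g′≋g ,
           trans (cong₂ _⊕_ (vanishes {at g′ a} {at g′ b} (at-≈ₛ g′≋g a) (at-≈ₛ g′≋g b)) Σ₁₄g′≡t)
                 (⊕-identityˡ t)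

    Σ₁₄-vanishable : ∀ n → 2 * suc n ≤ suc d → ∀ g → ∃[ g′ ] g′ ≋ₛ g × Σ₁₄ g′ 1 n ≡ 𝟘
    Σ₁₄-vanishable n range g =
      [ (λ Σ₁₄≡𝟘 → g , (λ _ → refl) , Σ₁₄≡𝟘) , (λ adjustable → adjustable 𝟘) ]′
        (Σ₁₄-dichotomy n 0 range g)

  π : U4 → U4bar
  π A = ub4 (a12 A) (a13 A) (a23 A) (a24 A) (a34 A)

  lift : U4bar → U4
  lift A = u4 (b12 A) (b13 A) 𝟘 (b23 A) (b24 A) (b34 A)

  relator-lift : ∀ {q d} → p ∣choose≤3 q → d % 2 ≡ 1 → (γ : Fin d → U4bar) →
                 Words.relator U4barG q γ ≡ oneU4bar → ∃[ γ′ ] relator q γ′ ≡ oneU4 × γ′ ≋ₛ lift ∘ γ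
  relator-lift {q} {d} p∣q d-odd γ γ-relator = adjusted-lift (Σ₁₄-vanishable m range γ̃)
    where
    m : ℕ
    m = d / 2
    γ̃ : Fin d → U4
    γ̃ = lift ∘ γ
    range : 2 * suc m ≤ suc d
    range = ≤-reflexive (trans (expand m) (cong suc (sym (trans (m≡m%n+[m/n]*n d 2) (cong (_+ m * 2) d-odd)))))
      where
      expand : ∀ m → 2 * suc m ≡ suc (1 + m * 2)
      expand = solve-∀
    -- π is a homomorphism on the nose, and π ∘ lift is the identity
    π-relator-γ̃ : π (derived (Σ₁₃ γ̃ 1 m) (Σ₁₄ γ̃ 1 m) (Σ₂₄ γ̃ 1 m)) ≡ oneU4bar
    π-relator-γ̃ = trans (cong π (sym (relator-derived p∣q γ̃)))
      (trans (relator-natural {U4G} {U4barG} π (λ _ _ → refl) (λ _ → refl) refl q γ̃) γ-relator)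
    adjusted-lift : ∃[ γ′ ] γ′ ≋ₛ γ̃ × Σ₁₄ γ′ 1 m ≡ 𝟘 →
                    ∃[ γ′ ] relator q γ′ ≡ oneU4 × γ′ ≋ₛ γ̃
    adjusted-lift (γ′ , γ′≋γ̃ , Σ₁₄≡𝟘) = γ′ , (begin
      relator q γ′
        ≡⟨ relator-derived p∣q γ′ ⟩
      derived (Σ₁₃ γ′ 1 m) (Σ₁₄ γ′ 1 m) (Σ₂₄ γ′ 1 m)
        ≡⟨ cong₂ (λ x z → derived x (Σ₁₄ γ′ 1 m) z) Σ₁₃≡𝟘 Σ₂₄≡𝟘 ⟩
      derived 𝟘 (Σ₁₄ γ′ 1 m) 𝟘
        ≡⟨ cong (λ y → derived 𝟘 y 𝟘) Σ₁₄≡𝟘 ⟩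
      oneU4
        ∎) , γ′≋γ̃
      where
      open ≡-Reasoning
      Σ₁₃≡𝟘 : Σ₁₃ γ′ 1 m ≡ 𝟘
      Σ₁₃≡𝟘 = trans (pairSum-cong _≈ₛ_ (a13 ∘₂ comm)
                                  (λ {A} {A′} {B} {B′} → comm-a13-cong {A} {A′} {B} {B′})
                                  {at γ′} {at γ̃} 1 m (λ j _ → at-≈ₛ γ′≋γ̃ j))
                    (cong b13 π-relator-γ̃)
      Σ₂₄≡𝟘 : Σ₂₄ γ′ 1 m ≡ 𝟘
      Σ₂₄≡𝟘 = trans (pairSum-cong _≈ₛ_ (a24 ∘₂ comm)
                                  (λ {A} {A′} {B} {B′} → comm-a24-cong {A} {A′} {B} {B′})
                                  {at γ′} {at γ̃} 1 m (λ j _ → at-≈ₛ γ′≋γ̃ j))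
                    (cong b24 π-relator-γ̃)

proposition9p6 : (p : ℕ) .{{_ : NonZero p}} → Prime p →
    (d : ℕ) → 3 ≤ d → d % 2 ≡ 1 →
    (f : ℕ) → 1 ≤ f → 3 < p ^ f →
    (φ₁ φ₂ φ₃ : OneRelator.H1 p f d) →
    ¬ OneRelator.Essential p f d φ₁ φ₂ φ₃
proposition9p6 p p-prime d _ d-odd f _ 3<pᶠ φ₁ φ₂ φ₃ ((γ , γ-relator , γ-φ) , ¬contains-0) =
  ¬contains-0 (contains-0 (relator-lift (Binomials.prime-power-∣choose≤3 {f = f} p-prime 3<pᶠ) d-odd γ γ-relator))
  where
  open Lifting p p-prime
  open Groups p using (U4G; oneU4)
  contains-0 : ∃[ γ′ ] Words.relator U4G (p ^ f) γ′ ≡ oneU4 × γ′ ≋ₛ lift ∘ γ →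
               OneRelator.MasseyContainsZero p f d φ₁ φ₂ φ₃
  contains-0 (γ′ , γ′-relator , γ′≋γ) = γ′ , γ′-relator , λ i →
    trans (cong proj₁ (γ′≋γ i)) (proj₁ (γ-φ i)) ,
    trans (cong (proj₁ ∘ proj₂) (γ′≋γ i)) (proj₁ (proj₂ (γ-φ i))) ,
    trans (cong (proj₂ ∘ proj₂) (γ′≋γ i)) (proj₂ (proj₂ (γ-φ i)))
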